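{- Let $n \geq 1$ and let $\varphi$ be a Boolean formula in Precise Conjunctive Normal Form whose variables are among a set of $n$ variables. If some variable $x$ appears (uncomplemented) in $\varphi$ exactly $p(n) = 3^{n-1}$ times and its complement $\sim x$ appears in $\varphi$ more than $q(n) = 3^{n-1}-2^{n-1}$ times, then $\varphi$ has no satisfying truth assignment.
   Context: A literal is a variable $x$ or its complement $\sim x$. A clause is a (nonempty) disjunction of literals; a formula in conjunctive normal form is a conjunction of clauses. A Boolean formula is in Precise Conjunctive Normal Form (PCNF) if it is a conjunction of pairwise distinct clauses, where each clause is a disjunction of pairwise distinct literals and no clause contains both a variable and its complement. Clauses are identified as sets of literals. -}

module Defs where

open import Data.Nat using (ℕ)
open import Data.Fin using (Fin)
open import Data.Fin.Properties as FinP using ()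
open import Data.Bool using (Bool; true; false; not)
open import Data.Bool.Properties as BoolP using ()
open import Data.Product using (_×_; _,_; ∃)
open import Data.Product.Properties using (≡-dec)
open import Data.List using (List; []; _∷_; length; filter)
open import Data.List.Relation.Unary.Any using (Any)
open import Data.List.Relation.Unary.AllPairs using (AllPairs)
open import Data.List.Relation.Unary.Unique.Propositional using (Unique)
open import Data.List.Relation.Binary.Subset.Propositional using (_⊆_)
open import Data.List.Relation.Unary.All using (All)
open import Relation.Nullary using (¬_)
open import Relation.Binary.PropositionalEquality using (_≡_)
import Data.List.Membership.DecPropositional as DecMem

-- A literal over the variables Fin n: (v , true) is the variable v,
-- (v , false) is its complement ∼v.
Literal : ℕ → Set
Literal n = Fin n × Bool

pos neg : ∀ {n} → Fin n → Literal n
pos v = v , true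
neg v = v , false

complement : ∀ {n} → Literal n → Literal n
complement (v , b) = v , not b

_≟L_ : ∀ {n} (a b : Literal n) → Relation.Nullary.Dec (a ≡ b)
_≟L_ = ≡-dec FinP._≟_ BoolP._≟_

module M {n : ℕ} = DecMem (_≟L_ {n})
open M public using (_∈_; _∈?_)

Clause : ℕ → Set
Clause n = List (Literal n)

Formula : ℕ → Set
Formula n = List (Clause n)

SameClause : ∀ {n} → Clause n → Clause n → Set
SameClause c d = (c ⊆ d) × (d ⊆ c)

record PreciseClause {n : ℕ} (c : Clause n) : Set where
  field
    nonempty      : ∃ λ l → l ∈ c
    distinctLits  : Unique c
    noComplements : ∀ l → l ∈ c → ¬ (complement l ∈ c)

record IsPCNF {n : ℕ} (φ : Formula n) : Set where
  field
    clausesPrecise  : All PreciseClause φ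
    clausesDistinct : AllPairs (λ c d → ¬ SameClause c d) φ

-- Number of occurrences of a literal in φ (each clause contains it at most once,
-- so this is the number of clauses containing it).
occurrences : ∀ {n} → Literal n → Formula n → ℕ
occurrences l φ = length (filter (λ c → l ∈? c) φ)

Assignment : ℕ → Set
Assignment n = Fin n → Bool

_⊨L_ : ∀ {n} → Assignment n → Literal n → Set
σ ⊨L (v , b) = σ v ≡ b

_⊨C_ : ∀ {n} → Assignment n → Clause n → Set
σ ⊨C c = Any (σ ⊨L_) c

_⊨_ : ∀ {n} → Assignment n → Formula n → Set
σ ⊨ φ = All (σ ⊨C_) φ

Satisfiable : ∀ {n} → Formula n → Set
Satisfiable {n} φ = ∃ λ (σ : Assignment n) → σ ⊨ φ

{-# OPTIONS --safe #-}
-- Write n = m + 1 and fix a satisfying assignment σ. A precise clause containing the literal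
-- (x , b) is determined by its pattern on the other m variables: for each of them, absent or
-- present with a sign, so at most 3^m such clauses exist. If σ x is not b, each of these clauses
-- must be satisfied elsewhere, i.e. its pattern shares a literal with σ; the patterns sharing no
-- literal with σ number 2^m, leaving at most 3^m − 2^m clauses. Taking b to be the value falsified
-- by σ gives 3^m positive occurrences (impossible) or more than 3^m − 2^m negative ones.
module Submission where

open import Defs hiding (_∈_)
open import Data.Nat using (ℕ; _≤_; _<_; _∸_; _^_; zero; suc; _+_; _*_; z≤n; s≤s)
open import Data.Nat.Properties
  using (≤-<-trans; module ≤-Reasoning; <-irrefl; <⇒≱; m+n∸n≡m; m^n>0; ^-monoˡ-≤; ∸-monoʳ-<)
open import Data.Nat.Tactic.RingSolver using (solve-∀)
open import Data.Fin as Fin using (Fin; punchIn; punchOut) renaming (_≟_ to _≟F_)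
open import Data.Fin.Properties using (punchIn-punchOut)
open import Data.Bool using (Bool; true; false; not)
open import Data.Bool.Properties using (¬-not; not-¬) renaming (_≟_ to _≟B_)
open import Data.Maybe using (Maybe; just; nothing)
open import Data.Product using (_×_; _,_; ∃)
open import Data.Sum using (_⊎_; inj₁; inj₂)
open import Data.List using (List; []; _∷_; [_]; length; filter; map; _++_)
open import Data.List.Properties using (length-map; length-++; length-removeAt′)
open import Data.List.Relation.Unary.Any using (here; there; index; _─_)
open import Data.List.Relation.Unary.All as All using (All; []; _∷_)
import Data.List.Relation.Unary.All.Properties as All
open import Data.List.Relation.Unary.AllPairs as AllPairs using (AllPairs; []; _∷_)
import Data.List.Relation.Unary.AllPairs.Properties as AllPairs
open import Data.List.Relation.Unary.Unique.Propositional using (Unique)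
open import Data.List.Relation.Binary.Subset.Propositional using (_⊆_)
open import Data.List.Membership.Propositional using (_∈_; find)
open import Data.List.Membership.Propositional.Properties using (∈-map⁺; ∈-++⁺ˡ; ∈-++⁺ʳ)
open import Data.Vec using (Vec; []; _∷_; tabulate; lookup)
open import Data.Vec.Properties using (lookup∘tabulate)
open import Function using (_∘_)
open import Relation.Nullary using (¬_; yes; no; contradiction)
open import Relation.Binary.PropositionalEquality
  using (_≡_; _≢_; refl; sym; trans; cong; cong₂; subst; module ≡-Reasoning)

module _ {A : Set} where

  ∈-─⁺ : ∀ {x y : A} {ys} (x∈ys : x ∈ ys) → y ∈ ys → y ≢ x → y ∈ (ys ─ x∈ys)
  ∈-─⁺ (here refl) (here refl)   y≢x = contradiction refl y≢x
  ∈-─⁺ (here refl) (there y∈ys)  _   = y∈ys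
  ∈-─⁺ (there _)   (here y≡z)    _   = here y≡z
  ∈-─⁺ (there x∈ys) (there y∈ys) y≢x = there (∈-─⁺ x∈ys y∈ys y≢x)

  unique∧⊆⇒length≤ : ∀ {xs ys : List A} → Unique xs → xs ⊆ ys → length xs ≤ length ys
  unique∧⊆⇒length≤ {[]}     _ _ = z≤n
  unique∧⊆⇒length≤ {x ∷ xs} {ys} (x∉xs ∷ xs!) xs⊆ys =
    subst (suc (length xs) ≤_) (sym (length-removeAt′ ys (index x∈ys)))
      (s≤s (unique∧⊆⇒length≤ xs! (λ y∈xs → ∈-─⁺ x∈ys (xs⊆ys (there y∈xs)) (y≢x y∈xs))))
    where
    x∈ys : x ∈ ys
    x∈ys = xs⊆ys (here refl)
    y≢x : ∀ {y} → y ∈ xs → y ≢ x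
    y≢x y∈xs y≡x = All.lookup x∉xs y∈xs (sym y≡x)

  AllPairs-within : ∀ {P : A → Set} {R S : A → A → Set} {xs} → (∀ {x y} → P x → P y → R x y → S x y) →
                    All P xs → AllPairs R xs → AllPairs S xs
  AllPairs-within f []         []         = []
  AllPairs-within f (px ∷ pxs) (rx ∷ rxs) =
    All.zipWith (λ (py , r) → f px py r) (pxs , rx) ∷ AllPairs-within f pxs rxs

  length-map-++³ : ∀ {B : Set} {f g h : B → A} xs ys zs →
                   length (map f xs ++ map g ys ++ map h zs) ≡ length xs + (length ys + length zs)
  length-map-++³ {f = f} {g} {h} xs ys zs =
    trans (length-++ (map f xs))
      (cong₂ _+_ (length-map f xs)
        (trans (length-++ (map g ys)) (cong₂ _+_ (length-map g ys) (length-map h zs))))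

-- nothing: the variable does not occur; just b: it occurs with sign b.
Pattern : ℕ → Set
Pattern k = Vec (Maybe Bool) k

patterns : ∀ k → List (Pattern k)
patterns zero    = [ [] ]
patterns (suc k) =
  map (nothing ∷_) (patterns k) ++ map (just true ∷_) (patterns k) ++ map (just false ∷_) (patterns k)

length-patterns : ∀ k → length (patterns k) ≡ 3 ^ k
length-patterns zero    = refl
length-patterns (suc k) = begin
  length (patterns (suc k))
    ≡⟨ length-map-++³ (patterns k) (patterns k) (patterns k) ⟩
  length (patterns k) + (length (patterns k) + length (patterns k))
    ≡⟨ cong (λ p → p + (p + p)) (length-patterns k) ⟩
  3 ^ k + (3 ^ k + 3 ^ k)
    ≡⟨ thrice (3 ^ k) ⟩
  3 * 3 ^ k ∎
  where
  open ≡-Reasoning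
  thrice : ∀ a → a + (a + a) ≡ 3 * a
  thrice = solve-∀

∈-patterns : ∀ {k} (w : Pattern k) → w ∈ patterns k
∈-patterns []             = here refl
∈-patterns (nothing ∷ w)  = ∈-++⁺ˡ (∈-map⁺ _ (∈-patterns w))
∈-patterns {suc k} (just true ∷ w)  =
  ∈-++⁺ʳ (map (nothing ∷_) (patterns k)) (∈-++⁺ˡ (∈-map⁺ _ (∈-patterns w)))
∈-patterns {suc k} (just false ∷ w) =
  ∈-++⁺ʳ (map (nothing ∷_) (patterns k))
    (∈-++⁺ʳ (map (just true ∷_) (patterns k)) (∈-map⁺ _ (∈-patterns w)))

Meets : ∀ {k} → Pattern k → Vec Bool k → Set
Meets w t = ∃ λ i → lookup w i ≡ just (lookup t i)

meeting : ∀ {k} → Vec Bool k → List (Pattern k)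
meeting []      = []
meeting {suc k} (b ∷ t) =
  map (just b ∷_) (patterns k) ++ map (nothing ∷_) (meeting t) ++ map (just (not b) ∷_) (meeting t)

length-meeting : ∀ {k} (t : Vec Bool k) → length (meeting t) + 2 ^ k ≡ 3 ^ k
length-meeting []      = refl
length-meeting {suc k} (b ∷ t) = begin
  length (meeting (b ∷ t)) + 2 * 2 ^ k
    ≡⟨ cong (_+ 2 * 2 ^ k) (length-map-++³ (patterns k) (meeting t) (meeting t)) ⟩
  length (patterns k) + (length (meeting t) + length (meeting t)) + 2 * 2 ^ k
    ≡⟨ regroup (length (patterns k)) (length (meeting t)) (2 ^ k) ⟩
  length (patterns k) + 2 * (length (meeting t) + 2 ^ k)
    ≡⟨ cong₂ (λ p q → p + 2 * q) (length-patterns k) (length-meeting t) ⟩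
  3 ^ k + 2 * 3 ^ k
    ≡⟨ thrice (3 ^ k) ⟩
  3 * 3 ^ k ∎
  where
  open ≡-Reasoning
  regroup : ∀ p q r → p + (q + q) + 2 * r ≡ p + 2 * (q + r)
  regroup = solve-∀
  thrice : ∀ a → a + 2 * a ≡ 3 * a
  thrice = solve-∀

∈-meeting : ∀ {k} (w : Pattern k) (t : Vec Bool k) → Meets w t → w ∈ meeting t
∈-meeting (a ∷ w) (b ∷ t) (Fin.zero , refl) = ∈-++⁺ˡ (∈-map⁺ _ (∈-patterns w))
∈-meeting {suc k} (nothing ∷ w) (b ∷ t) (Fin.suc i , hit) =
  ∈-++⁺ʳ (map (just b ∷_) (patterns k)) (∈-++⁺ˡ (∈-map⁺ _ (∈-meeting w t (i , hit))))
∈-meeting {suc k} (just a ∷ w) (b ∷ t) (Fin.suc i , hit) with a ≟B b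
... | yes refl = ∈-++⁺ˡ (∈-map⁺ _ (∈-patterns w))
... | no a≢b rewrite ¬-not a≢b =
  ∈-++⁺ʳ (map (just b ∷_) (patterns k))
    (∈-++⁺ʳ (map (nothing ∷_) (meeting t)) (∈-map⁺ _ (∈-meeting w t (i , hit))))

trace : ∀ {n} → Clause n → Fin n → Maybe Bool
trace c v with pos v ∈? c | neg v ∈? c
... | yes _ | _     = just true
... | no _  | yes _ = just false
... | no _  | no _  = nothing

∈-trace : ∀ {n} {c : Clause n} {v b} → trace c v ≡ just b → (v , b) ∈ c
∈-trace {c = c} {v} eq with pos v ∈? c | neg v ∈? c
∈-trace refl | yes v∈c | _        = v∈c
∈-trace refl | no _    | yes ∼v∈c = ∼v∈c
∈-trace ()   | no _    | no _

same-sign : ∀ {n} {c : Clause n} {v a b} → PreciseClause c → (v , a) ∈ c → (v , b) ∈ c → a ≡ b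
same-sign {c = c} {v} {a} {b} pc va∈c vb∈c with a ≟B b
... | yes a≡b = a≡b
... | no a≢b  = contradiction (subst (λ s → (v , s) ∈ c) (¬-not (a≢b ∘ sym)) vb∈c)
                              (PreciseClause.noComplements pc _ va∈c)

trace-∈ : ∀ {n} {c : Clause n} {v b} → PreciseClause c → (v , b) ∈ c → trace c v ≡ just b
trace-∈ {c = c} {v} {b} pc vb∈c with pos v ∈? c | neg v ∈? c
... | yes v∈c | _        = cong just (same-sign pc v∈c vb∈c)
... | no _    | yes ∼v∈c = cong just (same-sign pc ∼v∈c vb∈c)
... | no v∉c  | no ∼v∉c  with b
...   | true  = contradiction vb∈c v∉c
...   | false = contradiction vb∈c ∼v∉c

PreciseWith : ∀ {n} → Literal n → Clause n → Set
PreciseWith l c = PreciseClause c × l ∈ c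

module _ {m} (x : Fin (suc m)) where

  patternOf : Clause (suc m) → Pattern m
  patternOf c = tabulate (trace c ∘ punchIn x)

  restrict : Assignment (suc m) → Vec Bool m
  restrict σ = tabulate (σ ∘ punchIn x)

  x-or-punchIn : ∀ v → v ≡ x ⊎ ∃ λ i → punchIn x i ≡ v
  x-or-punchIn v with v ≟F x
  ... | yes v≡x = inj₁ v≡x
  ... | no v≢x  = inj₂ (punchOut (v≢x ∘ sym) , punchIn-punchOut (v≢x ∘ sym))

  patternOf-injective : ∀ {b c d} → PreciseWith (x , b) c → PreciseWith (x , b) d →
                        patternOf c ≡ patternOf d → c ⊆ d
  patternOf-injective {c = c} {d} (pc , xb∈c) (_ , xb∈d) c≡d {v , a} va∈c with x-or-punchIn v
  ... | inj₁ refl rewrite same-sign pc va∈c xb∈c = xb∈d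
  ... | inj₂ (i , refl) = ∈-trace (begin
    trace d (punchIn x i)     ≡⟨ lookup∘tabulate _ i ⟨
    lookup (patternOf d) i    ≡⟨ cong (λ w → lookup w i) c≡d ⟨
    lookup (patternOf c) i    ≡⟨ lookup∘tabulate _ i ⟩
    trace c (punchIn x i)     ≡⟨ trace-∈ pc va∈c ⟩
    just a                    ∎)
    where open ≡-Reasoning

  patternOf-meets : ∀ {b c} {σ : Assignment (suc m)} → PreciseWith (x , b) c → σ x ≡ not b → σ ⊨C c →
                    Meets (patternOf c) (restrict σ)
  patternOf-meets {c = c} {σ} (pc , xb∈c) σx≡¬b σ⊨c with find σ⊨c
  ... | (v , a) , va∈c , σv≡a with x-or-punchIn v
  ...   | inj₁ refl = contradiction (trans (same-sign pc xb∈c va∈c) (trans (sym σv≡a) σx≡¬b)) (not-¬ refl)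
  ...   | inj₂ (i , refl) = i , (begin
    lookup (patternOf c) i    ≡⟨ lookup∘tabulate _ i ⟩
    trace c (punchIn x i)     ≡⟨ trace-∈ pc va∈c ⟩
    just a                    ≡⟨ cong just σv≡a ⟨
    just (σ (punchIn x i))    ≡⟨ cong just (lookup∘tabulate _ i) ⟨
    just (lookup (restrict σ) i) ∎)
    where open ≡-Reasoning

  occurrences≤ : ∀ {φ : Formula (suc m)} {σ b} → IsPCNF φ → σ ⊨ φ → σ x ≡ not b →
                 occurrences (x , b) φ ≤ 3 ^ m ∸ 2 ^ m
  occurrences≤ {φ} {σ} {b} pcnf σ⊨φ σx≡¬b = begin
    occurrences (x , b) φ                          ≡⟨ length-map patternOf clauses ⟨
    length (map patternOf clauses)                 ≤⟨ unique∧⊆⇒length≤ patterns-unique (All.lookup patterns-meet) ⟩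
    length (meeting (restrict σ))                  ≡⟨ m+n∸n≡m _ (2 ^ m) ⟨
    length (meeting (restrict σ)) + 2 ^ m ∸ 2 ^ m  ≡⟨ cong (_∸ 2 ^ m) (length-meeting (restrict σ)) ⟩
    3 ^ m ∸ 2 ^ m                                  ∎
    where
    open ≤-Reasoning

    clauses : Formula (suc m)
    clauses = filter (λ c → (x , b) ∈? c) φ

    precise : All (PreciseWith (x , b)) clauses
    precise = All.zip (All.filter⁺ _ (IsPCNF.clausesPrecise pcnf) , All.all-filter _ φ)

    patterns-unique : Unique (map patternOf clauses)
    patterns-unique = AllPairs.map⁺ (AllPairs-within
      (λ pc pd c≉d c≡d → c≉d (patternOf-injective pc pd c≡d , patternOf-injective pd pc (sym c≡d)))
      precise (AllPairs.filter⁺ _ (IsPCNF.clausesDistinct pcnf)))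

    patterns-meet : All (_∈ meeting (restrict σ)) (map patternOf clauses)
    patterns-meet = All.map⁺ (All.zipWith
      (λ (pc , σ⊨c) → ∈-meeting (patternOf _) (restrict σ) (patternOf-meets pc σx≡¬b σ⊨c))
      (precise , All.filter⁺ _ σ⊨φ))

corollary3 : (n : ℕ) → 1 ≤ n → (φ : Formula n) → IsPCNF φ → (x : Fin n)
    → occurrences (pos x) φ ≡ 3 ^ (n ∸ 1)
    → 3 ^ (n ∸ 1) ∸ 2 ^ (n ∸ 1) < occurrences (neg x) φ
    → ¬ Satisfiable φ
corollary3 (suc m) _ φ pcnf x pos≡3^m 3^m∸2^m<neg (σ , σ⊨φ) with σ x in σx
... | false = <-irrefl pos≡3^m (≤-<-trans (occurrences≤ x pcnf σ⊨φ σx) 3^m∸2^m<3^m)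
  where
  3^m∸2^m<3^m : 3 ^ m ∸ 2 ^ m < 3 ^ m
  3^m∸2^m<3^m = ∸-monoʳ-< (m^n>0 2 m) (^-monoˡ-≤ m (s≤s (s≤s z≤n)))
... | true  = <⇒≱ 3^m∸2^m<neg (occurrences≤ x pcnf σ⊨φ σx)
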